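{- Let $n\ge 3$ and $k\ge 0$ be integers and let $G_n^k$ be the graph of critical pairs of the crown $S_n^k$. Then the maximum size of an independent set in $G_n^k$ is $(k+1)(k+2)/2$.
   Context: The crown $S_n^k$ is the height-2 poset on $A\cup B$, where $A=\{a_1,\dots,a_{n+k}\}$ is the set of minimal elements and $B=\{b_1,\dots,b_{n+k}\}$ the set of maximal elements; indices are taken cyclically modulo $n+k$. For each $i$, $a_i$ is incomparable to $b_j$ when $j\in\{i,i+1,\dots,i+k\}$ (mod $n+k$), and $a_i<b_j$ otherwise. Let $\mathrm{Inc}(A,B)$ be the set of pairs $(a,b)\in A\times B$ with $a$ incomparable to $b$. The graph $G_n^k$ has vertex set $\mathrm{Inc}(A,B)$, with $(a,b)$ and $(x,y)$ adjacent iff $a<y$ and $x<b$ in $S_n^k$. -}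

module Defs where

open import Data.Nat using (ℕ; _+_; _≤_)
open import Data.Fin using (Fin; toℕ)
open import Data.Product using (Σ; _×_; _,_)
open import Data.Sum using (_⊎_)
open import Data.List using (List; length)
open import Data.List.Relation.Unary.All using (All)
open import Data.List.Relation.Unary.AllPairs using (AllPairs)
open import Data.List.Relation.Unary.Unique.Propositional using (Unique)
open import Relation.Nullary using (¬_)
open import Relation.Binary.PropositionalEquality using (_≡_)

-- The crown S_n^k: minimal elements a_i and maximal elements b_j,
-- indices i, j : Fin (n + k)  (i.e. 0 .. n+k-1, cyclic mod n+k).
-- a_i ∥ b_j  iff  j ≡ i + t (mod n+k) for some t ∈ {0,…,k}.
-- Cyclic addition written out explicitly (t ≤ k < n+k, so either j = i+t or j + (n+k) = i+t).
Inc : (n k : ℕ) → Fin (n + k) → Fin (n + k) → Set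
Inc n k i j = Σ ℕ λ t → t ≤ k × (toℕ j ≡ toℕ i + t ⊎ toℕ j + (n + k) ≡ toℕ i + t)

Less : (n k : ℕ) → Fin (n + k) → Fin (n + k) → Set
Less n k i j = ¬ Inc n k i j

-- Candidate vertices of G_n^k: pairs (a_i, b_j) (encoded by indices);
-- being an actual vertex means (a_i, b_j) ∈ Inc(A,B).
Pair : ℕ → ℕ → Set
Pair n k = Fin (n + k) × Fin (n + k)

IsVertex : (n k : ℕ) → Pair n k → Set
IsVertex n k (i , j) = Inc n k i j

Adj : (n k : ℕ) → Pair n k → Pair n k → Set
Adj n k (a , b) (x , y) = Less n k a y × Less n k x b

IsIndependent : (n k : ℕ) → List (Pair n k) → Set
IsIndependent n k S =
  Unique S × All (IsVertex n k) S × AllPairs (λ u v → ¬ Adj n k u v) S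

MaxIndependentSize : (n k : ℕ) → ℕ → Set
MaxIndependentSize n k s =
  (Σ (List (Pair n k)) λ S → IsIndependent n k S × length S ≡ s)
  × (∀ (S : List (Pair n k)) → IsIndependent n k S → length S ≤ s)

-- Put N = n + k and measure positions on the N-cycle by forward offsets, so that a_i ∥ b_j iff the
-- offset from i to j is at most k. The staircase {(a_i, b_j) : i ≤ j ≤ k} is independent and has
-- (k+1)(k+2)/2 elements. Conversely, let S be independent, Q the minimal elements it uses, and say
-- that a_t covers a_i when a_t is incomparable to every b paired with a_i in S. Independence makes
-- covering total on Q, so at least |Q|(|Q|+1)/2 ordered pairs of Q are covering pairs. For a_i ∈ Q,
-- measuring offsets from the covering element farthest behind a partner of a_i embeds the partners
-- of a_i and the elements covering it disjointly into {0, …, k+1}. Summing over Q gives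
-- |S| + |Q|(|Q|+1)/2 ≤ |Q|(k+2), and q(k+2) ≤ q(q+1)/2 + (k+1)(k+2)/2 finishes the bound.

module Submission where

open import Defs
open import Data.Nat using (ℕ; suc; _*_; _≤_)
open import Data.Nat.DivMod using (_/_)

open import Data.Nat.Properties
open import Algebra.Properties.CommutativeSemigroup +-commutativeSemigroup
  using (interchange; x∙yz≈y∙xz; xy∙z≈y∙xz)
open import Data.Bool.Base using (true; false; if_then_else_)
open import Data.Empty using (⊥-elim)
open import Data.Fin as Fin using (Fin; toℕ; inject≤)
open import Data.Fin.Properties using (toℕ<n; toℕ-injective; toℕ-inject≤; inject≤-injective; toℕ≤pred[n])
open import Data.List.Base using (List; []; _∷_; _++_; length; map; filter; allFin; deduplicate)
open import Data.List.Extrema.Nat using (argmax; argmax-all; f[xs]≤f[argmax])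
open import Data.List.Membership.Propositional using (_∈_; find)
open import Data.List.Membership.Propositional.Properties
  using (∈-map⁻; ∈-map⁺; ∈-filter⁺; ∈-filter⁻; ∈-deduplicate⁺; ∈-deduplicate⁻)
open import Data.List.Properties using (length-++; length-map; length-tabulate; filter-all; filter-accept; filter-reject)
open import Data.List.Relation.Binary.Disjoint.Propositional using (Disjoint)
open import Data.List.Relation.Unary.All as All using (All; []; _∷_; all?)
import Data.List.Relation.Unary.All.Properties as All
open import Data.List.Relation.Unary.All.Properties using (all-filter; ¬All⇒Any¬)
open import Data.List.Relation.Unary.AllPairs using (AllPairs; []; _∷_)
open import Data.List.Relation.Unary.Any using (here; there)
open import Data.List.Relation.Unary.Unique.Propositional using (Unique)
import Data.List.Relation.Unary.Unique.Propositional.Properties as Unique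
open import Data.List.Relation.Unary.Unique.DecPropositional.Properties using (deduplicate-!)
open import Data.Nat.Base using (zero; _+_; _<_; _∸_; s≤s; z≤n; NonZero; >-nonZero)
open import Data.Nat.DivMod
  using (_%_; m*n/n≡m; m≡m%n+[m/n]*n; m<n*o⇒m/o<n; [m+n]%n≡m%n; %-distribˡ-+; m<n⇒m%n≡m; m%n<n)
open import Data.Nat.ListAction using (sum)
open import Data.Nat.Tactic.RingSolver using (solve-∀)
import Data.Product as Product
open import Data.Product using (Σ; _×_; _,_; _,′_; proj₁; proj₂)
import Data.Sum as Sum
open import Data.Sum using (_⊎_; inj₁; inj₂; [_,_]; reduce)
open import Function.Base using (_∘_; id)
open import Level using (Level)
open import Relation.Binary.Core using (Rel)
open import Relation.Binary.Definitions using (Symmetric; DecidableEquality)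
open import Relation.Binary.PropositionalEquality
  using (_≡_; _≢_; refl; sym; trans; cong; cong₂; subst; subst₂; module ≡-Reasoning)
open import Relation.Nullary using (¬_; Dec; yes; no; does)
import Relation.Nullary.Decidable as Dec
open import Relation.Unary using (Pred; Decidable)

variable
  a p r : Level
  A K : Set a

-- Counting in lists

indicator : {P : Set p} → Dec P → ℕ
indicator d = if does d then 1 else 0

count : {P : Pred A p} → Decidable P → List A → ℕ
count P? xs = sum (map (indicator ∘ P?) xs)

indicator≡1 : {P : Set p} (d : Dec P) → P → indicator d ≡ 1
indicator≡1 (yes _) _ = refl
indicator≡1 (no ¬p) p = ⊥-elim (¬p p)

module _ {P : Pred A p} (P? : Decidable P) where

  length-filter≡count : ∀ xs → length (filter P? xs) ≡ count P? xs
  length-filter≡count [] = refl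
  length-filter≡count (x ∷ xs) with does (P? x)
  ... | true  = cong suc (length-filter≡count xs)
  ... | false = length-filter≡count xs

  count-none : ∀ {xs} → All (¬_ ∘ P) xs → count P? xs ≡ 0
  count-none [] = refl
  count-none {x ∷ _} (¬px ∷ ¬pxs) with P? x
  ... | yes px = ⊥-elim (¬px px)
  ... | no _   = count-none ¬pxs

sum-map-+ : (f g : A → ℕ) (xs : List A) →
            sum (map (λ x → f x + g x) xs) ≡ sum (map f xs) + sum (map g xs)
sum-map-+ f g [] = refl
sum-map-+ f g (x ∷ xs) =
  trans (cong (f x + g x +_) (sum-map-+ f g xs)) (interchange (f x) (g x) _ _)

sum-map-≤ : (f : A → ℕ) {c : ℕ} (xs : List A) → (∀ {x} → x ∈ xs → f x ≤ c) →
            sum (map f xs) ≤ length xs * c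
sum-map-≤ f [] _ = z≤n
sum-map-≤ f (x ∷ xs) f≤c = +-mono-≤ (f≤c (here refl)) (sum-map-≤ f xs (f≤c ∘ there))

module _ (_≟_ : DecidableEquality K) where

  count-≟-unique : ∀ {c cs} → Unique cs → c ∈ cs → count (c ≟_) cs ≡ 1
  count-≟-unique {c} (c∉cs ∷ _) (here refl) with c ≟ c
  ... | yes _   = cong suc (count-none (c ≟_) c∉cs)
  ... | no c≢c = ⊥-elim (c≢c refl)
  count-≟-unique {c} {x ∷ _} (x∉cs ∷ u) (there c∈cs) with c ≟ x
  ... | yes refl = ⊥-elim (All.lookup x∉cs c∈cs refl)
  ... | no _     = count-≟-unique u c∈cs

  length≡sum-fibre-counts : (key : A → K) {cs : List K} → Unique cs → ∀ xs → All (λ x → key x ∈ cs) xs →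
                            length xs ≡ sum (map (λ c → count (λ x → key x ≟ c) xs) cs)
  length≡sum-fibre-counts key {cs} _ [] [] = sym (sum-map-0 cs)
    where
    sum-map-0 : ∀ (cs : List K) → sum (map (λ _ → 0) cs) ≡ 0
    sum-map-0 [] = refl
    sum-map-0 (_ ∷ cs) = sum-map-0 cs
  length≡sum-fibre-counts key {cs} u (x ∷ xs) (x∈cs ∷ xs∈cs) = begin
    suc (length xs)
      ≡⟨ cong₂ _+_ (sym (count-≟-unique u x∈cs)) (length≡sum-fibre-counts key u xs xs∈cs) ⟩
    count (key x ≟_) cs + sum (map (λ c → count (λ x → key x ≟ c) xs) cs)
      ≡⟨ sum-map-+ _ _ cs ⟨
    sum (map (λ c → count (λ x → key x ≟ c) (x ∷ xs)) cs) ∎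
    where open ≡-Reasoning

module _ {P Q : Pred A p} (P? : Decidable P) (Q? : Decidable Q) where

  length≤count+count : ∀ xs → All (λ x → P x ⊎ Q x) xs → length xs ≤ count P? xs + count Q? xs
  length≤count+count [] [] = z≤n
  length≤count+count (x ∷ xs) (px⊎qx ∷ rest) with P? x | Q? x
  ... | yes _ | _     = s≤s (≤-trans (length≤count+count xs rest) (+-monoʳ-≤ (count P? xs) (m≤n+m _ _)))
  ... | no _  | yes _ = ≤-trans (s≤s (length≤count+count xs rest)) (≤-reflexive (sym (+-suc _ _)))
  ... | no ¬p | no ¬q = ⊥-elim ([ ¬p , ¬q ] px⊎qx)

unique-<⇒length≤ : ∀ m {xs : List ℕ} → Unique xs → All (_< m) xs → length xs ≤ m
unique-<⇒length≤ zero {[]} _ _ = z≤n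
unique-<⇒length≤ zero {_ ∷ _} _ (() ∷ _)
unique-<⇒length≤ (suc m) {xs} u xs<1+m =
  ≤-trans (length≤1+length-filter-< u xs<1+m)
          (s≤s (unique-<⇒length≤ m (Unique.filter⁺ (_<? m) u) (all-filter (_<? m) xs)))
  where
  length≤1+length-filter-< : ∀ {xs} → Unique xs → All (_< suc m) xs →
                             length xs ≤ suc (length (filter (_<? m) xs))
  length≤1+length-filter-< [] [] = z≤n
  length≤1+length-filter-< {x ∷ xs} (x∉xs ∷ u) (x<1+m ∷ xs<1+m) with x <? m
  ... | yes x<m rewrite filter-accept (_<? m) {xs = xs} x<m =
    s≤s (length≤1+length-filter-< u xs<1+m)
  ... | no x≮m rewrite filter-reject (_<? m) {xs = xs} x≮m =
    s≤s (≤-reflexive (cong length (sym (filter-all (_<? m) xs<m))))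
    where
    x≡m : x ≡ m
    x≡m = ≤-antisym (≤-pred x<1+m) (≮⇒≥ x≮m)
    xs<m : All (_< m) xs
    xs<m = All.zipWith (λ (y<1+m , x≢y) → ≤∧≢⇒< (≤-pred y<1+m) (λ y≡m → x≢y (trans x≡m (sym y≡m))))
                       (xs<1+m , x∉xs)

AllPairs⇒∈-∈ : {R : Rel A r} {xs : List A} → Symmetric R → (∀ {x} → x ∈ xs → R x x) → AllPairs R xs →
               ∀ {x y} → x ∈ xs → y ∈ xs → R x y
AllPairs⇒∈-∈ sym refl-on (_ ∷ _)   (here refl) (here refl) = refl-on (here refl)
AllPairs⇒∈-∈ sym refl-on (Rx ∷ _)  (here refl) (there y∈) = All.lookup Rx y∈
AllPairs⇒∈-∈ sym refl-on (Rx ∷ _)  (there x∈) (here refl) = sym (All.lookup Rx x∈)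
AllPairs⇒∈-∈ sym refl-on (_ ∷ Rxs) (there x∈) (there y∈) = AllPairs⇒∈-∈ sym (refl-on ∘ there) Rxs x∈ y∈

All⇒AllPairs : {P : Pred A p} {R : Rel A r} → (∀ {x y} → P x → P y → R x y) →
               ∀ {xs} → All P xs → AllPairs R xs
All⇒AllPairs R-from-P [] = []
All⇒AllPairs R-from-P (px ∷ pxs) = All.map (R-from-P px) pxs ∷ All⇒AllPairs R-from-P pxs

unique-map-proj₂ : {B : Set a} {c : A} {xs : List (A × B)} →
                   All (λ u → proj₁ u ≡ c) xs → Unique xs → Unique (map proj₂ xs)
unique-map-proj₂ {c = c} fst≡c u = Unique.map⁻ (subst Unique (sym (pair-back fst≡c)) u)
  where
  pair-back : ∀ {xs} → All (λ u → proj₁ u ≡ c) xs → map (c ,_) (map proj₂ xs) ≡ xs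
  pair-back [] = refl
  pair-back (refl ∷ fst≡c) = cong (_ ∷_) (pair-back fst≡c)

-- Triangular numbers

triangular : ℕ → ℕ
triangular zero = 0
triangular (suc m) = suc m + triangular m

triangular*2 : ∀ m → triangular m * 2 ≡ m * suc m
triangular*2 zero = refl
triangular*2 (suc m) = begin
  (suc m + triangular m) * 2   ≡⟨ *-distribʳ-+ 2 (suc m) (triangular m) ⟩
  suc m * 2 + triangular m * 2 ≡⟨ cong (suc m * 2 +_) (triangular*2 m) ⟩
  suc m * 2 + m * suc m        ≡⟨ expand m ⟩
  suc m * suc (suc m)          ∎
  where
  open ≡-Reasoning
  expand : ∀ m → suc m * 2 + m * suc m ≡ suc m * suc (suc m)
  expand = solve-∀

triangular≡m*[1+m]/2 : ∀ m → triangular m ≡ m * suc m / 2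
triangular≡m*[1+m]/2 m = trans (sym (m*n/n≡m (triangular m) 2)) (cong (_/ 2) (triangular*2 m))

*≤triangular+triangular : ∀ q c → q * suc c ≤ triangular q + triangular c
*≤triangular+triangular zero c = z≤n
*≤triangular+triangular (suc q) zero = begin
  suc q * 1                     ≡⟨ *-identityʳ (suc q) ⟩
  suc q                         ≤⟨ m≤m+n (suc q) (triangular q + 0) ⟩
  suc q + (triangular q + 0)    ≡⟨ +-assoc (suc q) (triangular q) 0 ⟨
  triangular (suc q) + 0        ∎
  where open ≤-Reasoning
*≤triangular+triangular (suc q) (suc c) = begin
  suc q * suc (suc c)                                   ≡⟨ expand q c ⟩
  (suc q + suc c) + q * suc c                           ≤⟨ +-monoʳ-≤ (suc q + suc c) (*≤triangular+triangular q c) ⟩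
  (suc q + suc c) + (triangular q + triangular c)       ≡⟨ interchange (suc q) (suc c) (triangular q) (triangular c) ⟩
  triangular (suc q) + triangular (suc c)               ∎
  where
  open ≤-Reasoning
  expand : ∀ q c → suc q * suc (suc c) ≡ (suc q + suc c) + q * suc c
  expand = solve-∀

module _ {R : Rel A r} (R? : ∀ x → Decidable (R x)) (total : ∀ x y → R x y ⊎ R y x) where

  triangular≤count-pairs : ∀ xs → triangular (length xs) ≤ sum (map (λ x → count (R? x) xs) xs)
  triangular≤count-pairs [] = z≤n
  triangular≤count-pairs (x ∷ xs) = begin
    suc (length xs) + triangular (length xs)
      ≤⟨ +-mono-≤ (s≤s (length≤count+count (R? x) (λ y → R? y x) xs (All.tabulate λ {y} _ → total x y)))
                  (triangular≤count-pairs xs) ⟩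
    suc (from-x + to-x) + pairs xs
      ≡⟨ cong suc (+-assoc from-x to-x (pairs xs)) ⟩
    1 + from-x + (to-x + pairs xs)
      ≡⟨ cong (λ c → c + from-x + (to-x + pairs xs)) (indicator≡1 (R? x x) (reduce (total x x))) ⟨
    indicator (R? x x) + from-x + (to-x + pairs xs)
      ≡⟨ cong (indicator (R? x x) + from-x +_) (sum-map-+ (λ y → indicator (R? y x)) (λ y → count (R? y) xs) xs) ⟨
    pairs (x ∷ xs) ∎
    where
    open ≤-Reasoning
    pairs : List A → ℕ
    pairs ys = sum (map (λ y → count (R? y) ys) ys)
    from-x to-x : ℕ
    from-x = count (R? x) xs
    to-x = count (λ y → R? y x) xs

-- Forward offsets on a cycle

m<n+n⇒m%n≡m⊎m%n+n≡m : ∀ {m} n .{{_ : NonZero n}} → m < n + n → m % n ≡ m ⊎ m % n + n ≡ m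
m<n+n⇒m%n≡m⊎m%n+n≡m {m} n m<n+n
  with m / n | m<n*o⇒m/o<n {m} {2} (subst (m <_) (cong (n +_) (sym (+-identityʳ n))) m<n+n) | m≡m%n+[m/n]*n m n
... | 0 | _ | m≡ = inj₁ (sym (trans m≡ (+-identityʳ _)))
... | 1 | _ | m≡ = inj₂ (sym (trans m≡ (cong (m % n +_) (+-identityʳ n))))
... | suc (suc _) | s≤s (s≤s ()) | _

module Cyclic (N : ℕ) .{{_ : NonZero N}} where

  -- With N = n + k, Inc n k i j unfolds to Σ[ t ∈ ℕ ] t ≤ k × Arc i t j.
  Arc : Fin N → ℕ → Fin N → Set
  Arc i d j = toℕ j ≡ toℕ i + d ⊎ toℕ j + N ≡ toℕ i + d

  offset : Fin N → Fin N → ℕ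
  offset i j = (toℕ j + (N ∸ toℕ i)) % N

  offset<N : ∀ i j → offset i j < N
  offset<N i j = m%n<n _ N

  private
    i+[N∸i]≡N : ∀ (i : Fin N) → toℕ i + (N ∸ toℕ i) ≡ N
    i+[N∸i]≡N i = m+[n∸m]≡n (<⇒≤ (toℕ<n i))

    i+[y+[N∸i]]≡y+N : ∀ (i : Fin N) y → toℕ i + (y + (N ∸ toℕ i)) ≡ y + N
    i+[y+[N∸i]]≡y+N i y = trans (x∙yz≈y∙xz (toℕ i) y _) (cong (y +_) (i+[N∸i]≡N i))

  arc-offset : ∀ i j → Arc i (offset i j) j
  arc-offset i j with m<n+n⇒m%n≡m⊎m%n+n≡m N (+-mono-<-≤ (toℕ<n j) (m∸n≤m N (toℕ i)))
  ... | inj₁ o≡m   = inj₂ (trans (sym (i+[y+[N∸i]]≡y+N i (toℕ j))) (cong (toℕ i +_) (sym o≡m)))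
  ... | inj₂ o+N≡m = inj₁ (+-cancelʳ-≡ N _ _ (begin
    toℕ j + N                    ≡⟨ i+[y+[N∸i]]≡y+N i (toℕ j) ⟨
    toℕ i + (toℕ j + (N ∸ toℕ i)) ≡⟨ cong (toℕ i +_) o+N≡m ⟨
    toℕ i + (offset i j + N)      ≡⟨ +-assoc (toℕ i) _ N ⟨
    toℕ i + offset i j + N        ∎))
    where open ≡-Reasoning

  arc⇒offset≡ : ∀ {i j d} → d < N → Arc i d j → offset i j ≡ d
  arc⇒offset≡ {i} {j} {d} d<N (inj₁ j≡i+d) = begin
    (toℕ j + (N ∸ toℕ i)) % N         ≡⟨ cong (λ y → (y + (N ∸ toℕ i)) % N) j≡i+d ⟩
    (toℕ i + d + (N ∸ toℕ i)) % N     ≡⟨ cong (_% N) (trans (xy∙z≈y∙xz (toℕ i) d _) (cong (d +_) (i+[N∸i]≡N i))) ⟩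
    (d + N) % N                       ≡⟨ [m+n]%n≡m%n d N ⟩
    d % N                             ≡⟨ m<n⇒m%n≡m d<N ⟩
    d                                 ∎
    where open ≡-Reasoning
  arc⇒offset≡ {i} {j} d<N (inj₂ j+N≡i+d) =
    trans (cong (_% N) (+-cancelˡ-≡ (toℕ i) _ _ (trans (i+[y+[N∸i]]≡y+N i (toℕ j)) j+N≡i+d))) (m<n⇒m%n≡m d<N)

  private
    no-wrap-clash : ∀ {x} {j j′ : Fin N} → toℕ j ≡ x → toℕ j′ + N ≢ x
    no-wrap-clash {j = j} {j′} j≡x j′+N≡x =
      <⇒≱ (toℕ<n j) (≤-trans (m≤n+m N (toℕ j′)) (≤-reflexive (trans j′+N≡x (sym j≡x))))

  arc-functional : ∀ {i d j j′} → Arc i d j → Arc i d j′ → j ≡ j′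
  arc-functional (inj₁ j≡) (inj₁ j′≡) = toℕ-injective (trans j≡ (sym j′≡))
  arc-functional (inj₁ j≡) (inj₂ j′+N≡) = ⊥-elim (no-wrap-clash j≡ j′+N≡)
  arc-functional (inj₂ j+N≡) (inj₁ j′≡) = ⊥-elim (no-wrap-clash j′≡ j+N≡)
  arc-functional (inj₂ j+N≡) (inj₂ j′+N≡) = toℕ-injective (+-cancelʳ-≡ N _ _ (trans j+N≡ (sym j′+N≡)))

  offset-injective : ∀ i {j j′} → offset i j ≡ offset i j′ → j ≡ j′
  offset-injective i {j} {j′} o≡o′ =
    arc-functional {i} (arc-offset i j) (subst (λ d → Arc i d j′) (sym o≡o′) (arc-offset i j′))

  offset-compose : ∀ i j l →
                   offset i j + offset j l ≡ offset i l ⊎ offset i j + offset j l ≡ offset i l + N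
  offset-compose i j l =
    Sum.map (λ s%N≡s → trans (sym s%N≡s) sum%N) (λ s%N+N≡s → trans (sym s%N+N≡s) (cong (_+ N) sum%N))
            (m<n+n⇒m%n≡m⊎m%n+n≡m N (+-mono-< (offset<N i j) (offset<N j l)))
    where
    sum%N : (offset i j + offset j l) % N ≡ offset i l
    sum%N = begin
      (offset i j + offset j l) % N
        ≡⟨ %-distribˡ-+ (toℕ j + (N ∸ toℕ i)) (toℕ l + (N ∸ toℕ j)) N ⟨
      (toℕ j + (N ∸ toℕ i) + (toℕ l + (N ∸ toℕ j))) % N
        ≡⟨ cong (_% N) (rearrange (toℕ j) (N ∸ toℕ i) (toℕ l) (N ∸ toℕ j)) ⟩
      (toℕ l + (N ∸ toℕ i) + (toℕ j + (N ∸ toℕ j))) % N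
        ≡⟨ cong (λ m → (toℕ l + (N ∸ toℕ i) + m) % N) (i+[N∸i]≡N j) ⟩
      (toℕ l + (N ∸ toℕ i) + N) % N
        ≡⟨ [m+n]%n≡m%n _ N ⟩
      offset i l ∎
      where
      open ≡-Reasoning
      rearrange : ∀ a b c d → a + b + (c + d) ≡ c + b + (a + d)
      rearrange = solve-∀

  offset[i,l]≡1+offset[i,j]⇒1+offset[l,j]≡N :
    ∀ i j l → offset i l ≡ suc (offset i j) → suc (offset l j) ≡ N
  offset[i,l]≡1+offset[i,j]⇒1+offset[l,j]≡N i j l o≡1+o =
    [ (λ sum≡ → ⊥-elim (m+1+n≢m (offset i j) (shift sum≡))) , (λ sum≡ → +-cancelˡ-≡ (offset i j) _ _ (shift sum≡)) ]
      (offset-compose i l j)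
    where
    shift : ∀ {m} → offset i l + offset l j ≡ m → offset i j + suc (offset l j) ≡ m
    shift sum≡ = trans (+-suc (offset i j) (offset l j)) (subst (λ o → o + offset l j ≡ _) o≡1+o sum≡)

  offset[t,e]≤offset[a,e]⇒offset[a,t]≤offset[a,e] :
    ∀ a t e → offset t e ≤ offset a e → offset a t ≤ offset a e
  offset[t,e]≤offset[a,e]⇒offset[a,t]≤offset[a,e] a t e te≤ae with offset-compose a t e
  ... | inj₁ sum≡ = ≤-trans (m≤m+n (offset a t) (offset t e)) (≤-reflexive sum≡)
  ... | inj₂ sum≡ = ⊥-elim (<⇒≱ (offset<N a t) (+-cancelʳ-≤ (offset t e) N (offset a t) (begin
    N + offset t e          ≡⟨ +-comm N (offset t e) ⟩
    offset t e + N          ≤⟨ +-monoˡ-≤ N te≤ae ⟩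
    offset a e + N          ≡⟨ sum≡ ⟨
    offset a t + offset t e ∎)))
    where open ≤-Reasoning

  -- Offsets from the point t* of T farthest behind b₀ send B into [1, k+1] and T into [0, k]; the
  -- images are disjoint since a t just after some b would be N − 1 > k steps behind it.
  bounded-offsets⇒length+length≤2+k :
    ∀ {k} {B T : List (Fin N)} {b₀ t₀} → suc k < N → Unique B → Unique T → b₀ ∈ B → t₀ ∈ T →
    (∀ {t b} → t ∈ T → b ∈ B → offset t b ≤ k) → length B + length T ≤ 2 + k
  bounded-offsets⇒length+length≤2+k {k} {B} {T} {b₀} {t₀} 1+k<N unique-B unique-T b₀∈B t₀∈T offsets≤k =
    subst (_≤ 2 + k) length-Z (unique-<⇒length≤ (2 + k) unique-Z Z<2+k)
    where
    t* : Fin N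
    t* = argmax (λ t → offset t b₀) t₀ T

    t*∈T : t* ∈ T
    t*∈T = argmax-all (λ t → offset t b₀) t₀∈T (All.tabulate id)

    T-near : ∀ {t} → t ∈ T → offset t* t ≤ k
    T-near {t} t∈T =
      ≤-trans (offset[t,e]≤offset[a,e]⇒offset[a,t]≤offset[a,e] t* t b₀ (All.lookup (f[xs]≤f[argmax] t₀ T) t∈T))
              (offsets≤k t*∈T b₀∈B)

    Z : List ℕ
    Z = map (suc ∘ offset t*) B ++ map (offset t*) T

    length-Z : length Z ≡ length B + length T
    length-Z = trans (length-++ (map (suc ∘ offset t*) B)) (cong₂ _+_ (length-map _ B) (length-map _ T))

    disjoint : Disjoint (map (suc ∘ offset t*) B) (map (offset t*) T)
    disjoint (v∈B′ , v∈T′) with ∈-map⁻ _ v∈B′ | ∈-map⁻ _ v∈T′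
    ... | b , b∈B , refl | t , t∈T , 1+o≡o =
      <⇒≱ 1+k<N (≤-trans (≤-reflexive (sym (offset[i,l]≡1+offset[i,j]⇒1+offset[l,j]≡N t* b t (sym 1+o≡o))))
                         (s≤s (offsets≤k t∈T b∈B)))

    unique-Z : Unique Z
    unique-Z = Unique.++⁺ (Unique.map⁺ (offset-injective t* ∘ suc-injective) unique-B)
                          (Unique.map⁺ (offset-injective t*) unique-T)
                          disjoint

    Z<2+k : All (_< 2 + k) Z
    Z<2+k = All.++⁺ (All.map⁺ (All.tabulate λ b∈B → s≤s (s≤s (offsets≤k t*∈T b∈B))))
                    (All.map⁺ (All.tabulate λ t∈T → s≤s (m≤n⇒m≤1+n (T-near t∈T))))

-- Staircases and the crown

staircase : (m : ℕ) → List (Fin m × Fin m)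
staircase zero = []
staircase (suc m) = map (Fin.zero ,′_) (allFin (suc m)) ++ map (Product.map Fin.suc Fin.suc) (staircase m)

length-staircase : ∀ m → length (staircase m) ≡ triangular m
length-staircase zero = refl
length-staircase (suc m) =
  trans (length-++ (map (Fin.zero ,′_) (allFin (suc m))))
        (cong₂ _+_ (trans (length-map _ (allFin (suc m))) (length-tabulate id))
                   (trans (length-map _ (staircase m)) (length-staircase m)))

unique-staircase : ∀ m → Unique (staircase m)
unique-staircase zero = []
unique-staircase (suc m) =
  Unique.++⁺ (Unique.map⁺ (cong proj₂) (Unique.allFin⁺ (suc m)))
             (Unique.map⁺ suc×suc-injective (unique-staircase m))
             disjoint
  where
  suc×suc-injective : ∀ {p q : Fin m × Fin m} → Product.map Fin.suc Fin.suc p ≡ Product.map Fin.suc Fin.suc q → p ≡ q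
  suc×suc-injective {_ , _} {_ , _} refl = refl
  disjoint : Disjoint (map (Fin.zero ,′_) (allFin (suc m))) (map (Product.map Fin.suc Fin.suc) (staircase m))
  disjoint (v∈zeros , v∈sucs)
    with ∈-map⁻ (Fin.zero ,′_) v∈zeros | ∈-map⁻ (Product.map Fin.suc Fin.suc) v∈sucs
  ... | _ , _ , refl | _ , _ , ()

staircase-ordered : ∀ m → All (λ (i , j) → toℕ i ≤ toℕ j) (staircase m)
staircase-ordered zero = []
staircase-ordered (suc m) =
  All.++⁺ (All.map⁺ (All.tabulate λ _ → z≤n)) (All.map⁺ (All.map s≤s (staircase-ordered m)))

module _ (n k : ℕ) (2≤n : 2 ≤ n) where

  private
    N : ℕ
    N = n + k

    1+k<N : suc k < N
    1+k<N = +-monoˡ-≤ k 2≤n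

    instance
      N-nonZero : NonZero N
      N-nonZero = >-nonZero (≤-trans (s≤s z≤n) 1+k<N)

  open Cyclic N

  Inc⇒offset≤ : ∀ {i j} → Inc n k i j → offset i j ≤ k
  Inc⇒offset≤ {i} (t , t≤k , arc) =
    subst (_≤ k) (sym (arc⇒offset≡ {i} (≤-<-trans t≤k (<⇒≤ 1+k<N)) arc)) t≤k

  offset≤⇒Inc : ∀ {i j} → offset i j ≤ k → Inc n k i j
  offset≤⇒Inc {i} {j} o≤k = offset i j , o≤k , arc-offset i j

  Inc? : ∀ i j → Dec (Inc n k i j)
  Inc? i j = Dec.map′ offset≤⇒Inc Inc⇒offset≤ (offset i j ≤? k)

  ≤⇒Inc : ∀ {i j : Fin N} → toℕ i ≤ toℕ j → toℕ j ≤ k → Inc n k i j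
  ≤⇒Inc {i} {j} i≤j j≤k =
    toℕ j ∸ toℕ i , ≤-trans (m∸n≤m (toℕ j) (toℕ i)) j≤k , inj₁ (sym (m+[n∸m]≡n i≤j))

  InStaircase : Pair n k → Set
  InStaircase (i , j) = toℕ i ≤ toℕ j × toℕ j ≤ k

  staircase-nonadjacent : ∀ {u v} → InStaircase u → InStaircase v → ¬ Adj n k u v
  staircase-nonadjacent {a , b} {x , y} (a≤b , b≤k) (x≤y , y≤k) (a<y , x<b) with toℕ a ≤? toℕ x
  ... | yes a≤x = a<y (≤⇒Inc (≤-trans a≤x x≤y) y≤k)
  ... | no a≰x  = x<b (≤⇒Inc (≤-trans (<⇒≤ (≰⇒> a≰x)) a≤b) b≤k)

  independent-staircase : Σ (List (Pair n k)) λ S → IsIndependent n k S × length S ≡ triangular (suc k)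
  independent-staircase =
    S₀ , (unique-S₀ , All.map (λ (i≤j , j≤k) → ≤⇒Inc i≤j j≤k) S₀-shaped , All⇒AllPairs staircase-nonadjacent S₀-shaped)
       , trans (length-map _ (staircase (suc k))) (length-staircase (suc k))
    where
    embed : Fin (suc k) → Fin N
    embed i = inject≤ i (<⇒≤ 1+k<N)
    S₀ : List (Pair n k)
    S₀ = map (Product.map embed embed) (staircase (suc k))
    unique-S₀ : Unique S₀
    unique-S₀ = Unique.map⁺ embed×embed-injective (unique-staircase (suc k))
      where
      embed×embed-injective : ∀ {p q} → Product.map embed embed p ≡ Product.map embed embed q → p ≡ q
      embed×embed-injective {_ , _} {_ , _} eq =
        cong₂ _,_ (inject≤-injective _ _ _ _ (cong proj₁ eq)) (inject≤-injective _ _ _ _ (cong proj₂ eq))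
    S₀-shaped : All InStaircase S₀
    S₀-shaped = All.map⁺ (All.map shaped (staircase-ordered (suc k)))
      where
      shaped : ∀ {p} → toℕ (proj₁ p) ≤ toℕ (proj₂ p) → InStaircase (Product.map embed embed p)
      shaped {i , j} i≤j rewrite toℕ-inject≤ i (<⇒≤ 1+k<N) | toℕ-inject≤ j (<⇒≤ 1+k<N) =
        i≤j , toℕ≤pred[n] j

  module _ {S : List (Pair n k)} (independent : IsIndependent n k S) where

    private
      unique-S : Unique S
      unique-S = proj₁ independent

      vertices : All (IsVertex n k) S
      vertices = proj₁ (proj₂ independent)

    nonadjacent : ∀ {u v} → u ∈ S → v ∈ S → ¬ Adj n k u v
    nonadjacent = AllPairs⇒∈-∈ (λ ¬uv vu → ¬uv (Product.swap vu))
                               (λ u∈S (a<b , _) → a<b (All.lookup vertices u∈S))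
                               (proj₂ (proj₂ independent))

    minimals : List (Fin N)
    minimals = deduplicate Fin._≟_ (map proj₁ S)

    inRow? : ∀ i → Decidable (λ (u : Pair n k) → proj₁ u ≡ i)
    inRow? i u = proj₁ u Fin.≟ i

    row : Fin N → List (Pair n k)
    row i = filter (inRow? i) S

    partners : Fin N → List (Fin N)
    partners i = map proj₂ (row i)

    partner⇒∈ : ∀ {i b} → b ∈ partners i → (i , b) ∈ S
    partner⇒∈ {i} b∈ with ∈-map⁻ proj₂ b∈
    ... | _ , u∈row , refl with ∈-filter⁻ (inRow? i) u∈row
    ...   | u∈S , refl = u∈S

    CoveredBy : Fin N → Fin N → Set
    CoveredBy i t = All (Inc n k t) (partners i)

    coveredBy? : ∀ i → Decidable (CoveredBy i)
    coveredBy? i t = all? (Inc? t) (partners i)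

    coveredBy-refl : ∀ i → CoveredBy i i
    coveredBy-refl i = All.tabulate (All.lookup vertices ∘ partner⇒∈)

    coveredBy-total : ∀ i t → CoveredBy i t ⊎ CoveredBy t i
    coveredBy-total i t with coveredBy? i t | coveredBy? t i
    ... | yes i↝t | _       = inj₁ i↝t
    ... | no _    | yes t↝i = inj₂ t↝i
    ... | no i↝̸t  | no t↝̸i with find (¬All⇒Any¬ (Inc? t) _ i↝̸t) | find (¬All⇒Any¬ (Inc? i) _ t↝̸i)
    ...   | b , b∈ , t<b | b′ , b′∈ , i<b′ = ⊥-elim (nonadjacent (partner⇒∈ b∈) (partner⇒∈ b′∈) (i<b′ , t<b))

    count-row+count-coveredBy≤2+k :
      ∀ {i} → i ∈ minimals → count (inRow? i) S + count (coveredBy? i) minimals ≤ 2 + k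
    count-row+count-coveredBy≤2+k {i} i∈minimals
      with ∈-map⁻ proj₁ (∈-deduplicate⁻ Fin._≟_ (map proj₁ S) i∈minimals)
    ... | u , u∈S , refl = subst₂ (λ r c → r + c ≤ 2 + k)
      (trans (length-map proj₂ (row i)) (length-filter≡count (inRow? i) S))
      (length-filter≡count (coveredBy? i) minimals)
      (bounded-offsets⇒length+length≤2+k 1+k<N
        (unique-map-proj₂ (all-filter (inRow? i) S) (Unique.filter⁺ (inRow? i) unique-S))
        (Unique.filter⁺ (coveredBy? i) (deduplicate-! Fin._≟_ (map proj₁ S)))
        (∈-map⁺ proj₂ (∈-filter⁺ (inRow? i) u∈S refl))
        (∈-filter⁺ (coveredBy? i) i∈minimals (coveredBy-refl i))
        (λ t∈ b∈ → Inc⇒offset≤ (All.lookup (proj₂ (∈-filter⁻ (coveredBy? i) {xs = minimals} t∈)) b∈)))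

    length+triangular≤length*[2+k] : length S + triangular (length minimals) ≤ length minimals * (2 + k)
    length+triangular≤length*[2+k] = begin
      length S + triangular (length minimals)
        ≤⟨ +-monoʳ-≤ (length S) (triangular≤count-pairs coveredBy? coveredBy-total minimals) ⟩
      length S + ∑ covering
        ≡⟨ cong (_+ ∑ covering) (length≡sum-fibre-counts Fin._≟_ proj₁ (deduplicate-! Fin._≟_ (map proj₁ S)) S
                                   (All.tabulate (∈-deduplicate⁺ Fin._≟_ ∘ ∈-map⁺ proj₁))) ⟩
      ∑ row-size + ∑ covering
        ≡⟨ sum-map-+ row-size covering minimals ⟨
      ∑ (λ i → row-size i + covering i)
        ≤⟨ sum-map-≤ _ minimals count-row+count-coveredBy≤2+k ⟩
      length minimals * (2 + k) ∎
      where
      open ≤-Reasoning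
      ∑ : (Fin N → ℕ) → ℕ
      ∑ f = sum (map f minimals)
      row-size covering : Fin N → ℕ
      row-size i = count (inRow? i) S
      covering i = count (coveredBy? i) minimals

  independent⇒length≤ : ∀ S → IsIndependent n k S → length S ≤ triangular (suc k)
  independent⇒length≤ S independent = +-cancelˡ-≤ (triangular q) _ _ (begin
    triangular q + length S       ≡⟨ +-comm (triangular q) (length S) ⟩
    length S + triangular q       ≤⟨ length+triangular≤length*[2+k] independent ⟩
    q * (2 + k)                   ≤⟨ *≤triangular+triangular q (suc k) ⟩
    triangular q + triangular (suc k) ∎)
    where
    open ≤-Reasoning
    q : ℕ
    q = length (minimals independent)

  maxIndependentSize : MaxIndependentSize n k (triangular (suc k))
  maxIndependentSize = independent-staircase , independent⇒length≤

theorem1p2 : ∀ (n k : ℕ) → 3 ≤ n → MaxIndependentSize n k ((suc k * suc (suc k)) / 2)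
theorem1p2 n k 3≤n =
  subst (MaxIndependentSize n k) (triangular≡m*[1+m]/2 (suc k)) (maxIndependentSize n k (<⇒≤ 3≤n))
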